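{- For every graph $G$ and every $a \in \mathbb{N}$, $$f_a(G) \leq \bigl(P_\ell(G, \chi_\ell(G) + a - 1)\bigr)^a.$$
   Context: All graphs are finite, simple and nonempty; $\mathbb{N}=\{1,2,3,\dots\}$. A list assignment $L$ for a graph $G$ assigns to each vertex $v$ a set $L(v)$ of colors; a proper $L$-coloring is a proper coloring $c$ with $c(v)\in L(v)$ for all $v$. $L$ is a $k$-assignment if $|L(v)|=k$ for all $v$. The list chromatic number $\chi_\ell(G)$ is the least $k$ such that $G$ has a proper $L$-coloring for every $k$-assignment $L$. $P(G,L)$ denotes the number of proper $L$-colorings of $G$, and the list color function $P_\ell(G,k)$ is the minimum of $P(G,L)$ over all $k$-assignments $L$ for $G$. The Cartesian product $G \square H$ has vertex set $V(G)\times V(H)$, with $(u,v)$ adjacent to $(u',v')$ iff either $u=u'$ and $vv'\in E(H)$, or $v=v'$ and $uu'\in E(G)$. $K_{a,b}$ is the complete bipartite graph with parts of sizes $a$ and $b$. For $a\in\mathbb{N}$, $f_a(G)$ denotes the smallest $b \in \mathbb{N}$ such that $\chi_\ell(G \square K_{a,b}) = \chi_\ell(G) + a$ (such $b$ exists). -}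

module Defs where

open import Data.Nat using (ℕ; zero; suc; _+_; _*_; _≤_; _<_; _≡ᵇ_; _<ᵇ_)
open import Data.Bool using (Bool; true; false; _∧_; _∨_; _xor_; not; if_then_else_)
open import Data.Fin using (Fin; zero; suc; toℕ; remQuot)
open import Data.Fin.Base using (Fin)
open import Data.Product using (Σ; _×_; _,_; proj₁; proj₂)
open import Data.List using (List; []; _∷_; length; map; concatMap; allFin)
open import Data.Bool.ListAction using (all)
open import Data.List.Membership.Propositional using (_∈_)
open import Data.List.Relation.Unary.Unique.Propositional using (Unique)
open import Data.Vec using (Vec; []; _∷_; lookup)
open import Relation.Binary.PropositionalEquality using (_≡_; _≢_)
open import Relation.Nullary using (¬_)

record Graph : Set where
  constructor mkGraph
  field
    n   : ℕ
    adj : Fin n → Fin n → Bool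

open Graph public

IsSimple : Graph → Set
IsSimple G = (∀ u v → adj G u v ≡ adj G v u) × (∀ v → adj G v v ≡ false)

IsNonempty : Graph → Set
IsNonempty G = 1 ≤ n G

ListAssignment : Graph → Set
ListAssignment G = Fin (n G) → List ℕ

IsKAssignment : (G : Graph) → ℕ → ListAssignment G → Set
IsKAssignment G k L = ∀ v → Unique (L v) × length (L v) ≡ k

IsProperLColoring : (G : Graph) → ListAssignment G → (Fin (n G) → ℕ) → Set
IsProperLColoring G L c =
  (∀ v → c v ∈ L v) × (∀ u v → adj G u v ≡ true → c u ≢ c v)

Choosable : Graph → ℕ → Set
Choosable G k = ∀ L → IsKAssignment G k L → Σ (Fin (n G) → ℕ) (IsProperLColoring G L)

IsListChromaticNumber : Graph → ℕ → Set
IsListChromaticNumber G k = Choosable G k × (∀ j → j < k → ¬ Choosable G j)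

allChoices : (m : ℕ) → (Fin m → List ℕ) → List (Vec ℕ m)
allChoices zero    L = [] ∷ []
allChoices (suc m) L =
  concatMap (λ x → map (x ∷_) (allChoices m (λ i → L (suc i)))) (L zero)

isProperᵇ : (G : Graph) → Vec ℕ (n G) → Bool
isProperᵇ G c =
  all (λ u → all (λ v → not (adj G u v ∧ (lookup c u ≡ᵇ lookup c v))) (allFin (n G)))
      (allFin (n G))

countTrue : {A : Set} → (A → Bool) → List A → ℕ
countTrue p []       = 0
countTrue p (x ∷ xs) = if p x then suc (countTrue p xs) else countTrue p xs

-- P(G, L): the number of proper L-colourings of G
-- (meaningful for assignments whose lists have no repetitions, e.g. k-assignments).
numLColorings : (G : Graph) → ListAssignment G → ℕ
numLColorings G L = countTrue (isProperᵇ G) (allChoices (n G) L)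

IsListColorFunction : Graph → ℕ → ℕ → Set
IsListColorFunction G k p =
  Σ (ListAssignment G) (λ L → IsKAssignment G k L × numLColorings G L ≡ p)
  × (∀ L → IsKAssignment G k L → p ≤ numLColorings G L)

K : ℕ → ℕ → Graph
K a b = mkGraph (a + b) (λ i j → (toℕ i <ᵇ a) xor (toℕ j <ᵇ a))

_□_ : Graph → Graph → Graph
G □ H = mkGraph (n G * n H) adjP
  where
  adjP : Fin (n G * n H) → Fin (n G * n H) → Bool
  adjP i j with remQuot {n G} (n H) i | remQuot {n G} (n H) j
  ... | (u , v) | (u' , v') =
    ((toℕ u ≡ᵇ toℕ u') ∧ adj H v v') ∨ ((toℕ v ≡ᵇ toℕ v') ∧ adj G u u')

IsF : Graph → ℕ → ℕ → ℕ → Set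
IsF G a χ b =
  1 ≤ b × IsListChromaticNumber (G □ K a b) (χ + a)
  × (∀ b' → 1 ≤ b' → b' < b → ¬ IsListChromaticNumber (G □ K a b') (χ + a))

-- Let L₀ be a (χ+a-1)-assignment of G with exactly P = P_ℓ(G, χ+a-1) proper colourings and
-- let S be any (χ-1)-assignment. In G □ K_{a,P^a}, give the copy of G at the α-th vertex of the
-- small side the list L₀ (in a private palette α), and the copy at the vertex indexed by an a-tuple
-- (c₁,…,c_a) of proper L₀-colourings the list S plus the colours c_α(u) (in palette α). A proper
-- colouring of the product restricts on the small side to some tuple (c₁,…,c_a); in the copy
-- indexed by exactly this tuple, u sees the colours c_α(u) on its neighbours, so it must take a
-- colour of S. As G is not (χ-1)-choosable, G □ K_{a,P^a} is therefore not (χ+a-1)-choosable; if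
-- f_a(G) exceeded P^a, this graph would also be a subgraph of the (χ+a)-choosable G □ K_{a,f_a(G)},
-- contradicting the minimality of f_a(G).

module Submission where

open import Defs
open import Function using (_∘_)
open import Function.Bundles using (module Equivalence)
open import Data.Bool using (Bool; true; false; _∧_; _∨_; _xor_; not; T)
open import Data.Bool.Properties using (T-≡; T-∨; T-∧; ∨-zeroʳ)
open import Data.Empty using (⊥-elim)
open import Data.Fin using (Fin; zero; suc; toℕ; combine; remQuot; inject≤; fromℕ<; _↑ˡ_; _↑ʳ_; splitAt; finToFun; funToFin)
open import Data.Fin.Properties
  using (remQuot-combine; combine-remQuot; toℕ-inject≤; toℕ-fromℕ<; toℕ<n; toℕ-injective;
         splitAt-↑ˡ; splitAt-↑ʳ; toℕ-↑ˡ; toℕ-↑ʳ; finToFun-funToFin)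
open import Data.List using (List; []; _∷_; length; map; filterᵇ; tabulate; take; upTo; _++_)
import Data.List as List
open import Data.List.Membership.Propositional using (_∈_)
open import Data.List.Membership.Propositional.Properties
  using (∈-map⁺; ∈-map⁻; ∈-concatMap⁺; ∈-filter⁺; ∈-++⁻; ∈-tabulate⁻)
open import Data.List.Properties using (length-take; length-upTo; length-map; length-++; length-tabulate)
import Data.List.Relation.Binary.Sublist.Propositional as Sublist
open import Data.List.Relation.Binary.Sublist.Propositional.Properties using (take-⊆)
open import Data.List.Relation.Unary.All.Properties using (all⁻) renaming (tabulate⁺ to All-tabulate⁺)
open import Data.List.Relation.Unary.AllPairs using ([])
open import Data.List.Relation.Unary.Any using (here; index)
import Data.List.Relation.Unary.Any as Any
open import Data.List.Relation.Unary.Any.Properties using (lookup-index)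
open import Data.List.Relation.Unary.Unique.Propositional using (Unique)
open import Data.List.Relation.Unary.Unique.Propositional.Properties using (take⁺; upTo⁺; map⁺; ++⁺; tabulate⁺)
open import Data.Maybe using (Maybe; just; nothing; maybe′)
import Data.Maybe as Maybe
open import Data.Nat using (ℕ; zero; suc; _+_; _*_; _∸_; _^_; _≤_; _<_; _≡ᵇ_; _<ᵇ_; _<?_; _⊓_; _%_; z<s; NonZero; >-nonZero)
open import Data.Nat.DivMod using (m<n⇒m%n≡m; [m+kn]%n≡m%n)
open import Data.Nat.Properties
  using (≡ᵇ⇒≡; ≡⇒≡ᵇ; <⇒<ᵇ; <ᵇ⇒<; m≤n⇒m⊓n≡m; +-monoʳ-≤; m≤m+n; <-irrefl; ≤-<-trans; n<1+n; m<n⇒m<1+n;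
         +-cancelˡ-≡; *-cancelʳ-≡; ≮⇒≥; <⇒≤; ≤-pred; +-comm; m^n>0)
open import Data.Product using (Σ; ∃; _×_; _,_; proj₁; proj₂; uncurry)
open import Data.Sum using (_⊎_; inj₁; inj₂)
open import Data.Vec using (Vec; []; _∷_)
import Data.Vec as Vec
open import Data.Vec.Properties using (lookup∘tabulate)
open import Relation.Nullary using (¬_; yes; no; contradiction)
open import Relation.Binary.PropositionalEquality

countTrue≡length-filterᵇ : {A : Set} (p : A → Bool) (xs : List A) →
                           countTrue p xs ≡ length (filterᵇ p xs)
countTrue≡length-filterᵇ p []       = refl
countTrue≡length-filterᵇ p (x ∷ xs) with p x
... | true  = cong suc (countTrue≡length-filterᵇ p xs)
... | false = countTrue≡length-filterᵇ p xs

∈-allChoices : ∀ m (L : Fin m → List ℕ) (xs : Vec ℕ m) →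
               (∀ i → Vec.lookup xs i ∈ L i) → xs ∈ allChoices m L
∈-allChoices zero    L []       xs∈L = here refl
∈-allChoices (suc m) L (x ∷ xs) xs∈L =
  ∈-concatMap⁺ (λ y → map (y ∷_) (allChoices m (L ∘ suc)))
    (Any.map (λ { refl → ∈-map⁺ (x ∷_) (∈-allChoices m (L ∘ suc) xs (xs∈L ∘ suc)) }) (xs∈L zero))

isProperᵇ-tabulate : (G : Graph) (c : Fin (n G) → ℕ) →
                     (∀ u v → adj G u v ≡ true → c u ≢ c v) → T (isProperᵇ G (Vec.tabulate c))
isProperᵇ-tabulate G c proper =
  all⁻ _ (All-tabulate⁺ λ u → all⁻ _ (All-tabulate⁺ λ v → edge-ok u v))
  where
  edge-ok : ∀ u v → T (not (adj G u v ∧ (Vec.lookup (Vec.tabulate c) u ≡ᵇ Vec.lookup (Vec.tabulate c) v)))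
  edge-ok u v rewrite lookup∘tabulate c u | lookup∘tabulate c v with adj G u v in uv
  ... | false = _
  ... | true with c u ≡ᵇ c v in cu≡cv
  ...   | false = _
  ...   | true  = ⊥-elim (proper u v uv (≡ᵇ⇒≡ (c u) (c v) (subst T (sym cu≡cv) _)))

-- Kept abstract: unfolding the enumeration makes type checking prohibitively slow.
abstract
  properColorings : (G : Graph) → ListAssignment G → List (Vec ℕ (n G))
  properColorings G L = filterᵇ (isProperᵇ G) (allChoices (n G) L)

  numLColorings≡length : (G : Graph) (L : ListAssignment G) →
                         numLColorings G L ≡ length (properColorings G L)
  numLColorings≡length G L = countTrue≡length-filterᵇ (isProperᵇ G) (allChoices (n G) L)

  ∈-properColorings : (G : Graph) (L : ListAssignment G) (c : Fin (n G) → ℕ) →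
                      IsProperLColoring G L c → Vec.tabulate c ∈ properColorings G L
  ∈-properColorings G L c (c∈L , proper) =
    ∈-filter⁺ _ (∈-allChoices (n G) L (Vec.tabulate c) λ i → subst (_∈ L i) (sym (lookup∘tabulate c i)) (c∈L i))
              (isProperᵇ-tabulate G c proper)

numLColorings>0 : (G : Graph) (L : ListAssignment G) {c : Fin (n G) → ℕ} →
                  IsProperLColoring G L c → 0 < numLColorings G L
numLColorings>0 G L c-proper rewrite numLColorings≡length G L
  with properColorings G L | ∈-properColorings G L _ c-proper
... | _ ∷ _ | _ = z<s

Choosable-mono : (G : Graph) {j k : ℕ} → j ≤ k → Choosable G j → Choosable G k
Choosable-mono G {j} j≤k choosable L L-isK =
  c , (λ v → Sublist.lookup (take-⊆ j (L v)) (proj₁ c-proper v)) , proj₂ c-proper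
  where
  truncated-isK : IsKAssignment G j (λ v → take j (L v))
  truncated-isK v = take⁺ j (proj₁ (L-isK v))
                  , trans (length-take j (L v)) (trans (cong (j ⊓_) (proj₂ (L-isK v))) (m≤n⇒m⊓n≡m j≤k))
  open Σ (choosable (λ v → take j (L v)) truncated-isK) renaming (proj₁ to c; proj₂ to c-proper)

¬Choosable-0 : (G : Graph) → IsNonempty G → ¬ Choosable G 0
¬Choosable-0 G nonempty choosable with proj₁ (proj₂ (choosable (λ _ → []) (λ _ → [] , refl))) (fromℕ< nonempty)
... | ()

□-adjᵖ : (G H : Graph) → Fin (n G) × Fin (n H) → Fin (n G) × Fin (n H) → Bool
□-adjᵖ G H (u , w) (u' , w') = ((toℕ u ≡ᵇ toℕ u') ∧ adj H w w') ∨ ((toℕ w ≡ᵇ toℕ w') ∧ adj G u u')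

adj-□-combine : (G H : Graph) (u u' : Fin (n G)) (w w' : Fin (n H)) →
                adj (G □ H) (combine u w) (combine u' w') ≡ □-adjᵖ G H (u , w) (u' , w')
adj-□-combine G H u u' w w' =
  cong₂ (□-adjᵖ G H) (remQuot-combine {n G} {n H} u w) (remQuot-combine {n G} {n H} u' w')

toℕ-≡ᵇ⇒≡ : ∀ {m} {i j : Fin m} → T (toℕ i ≡ᵇ toℕ j) → i ≡ j
toℕ-≡ᵇ⇒≡ {i = i} {j} t = toℕ-injective (≡ᵇ⇒≡ (toℕ i) (toℕ j) t)

□-Edge : (G H : Graph) → Fin (n G) × Fin (n H) → Fin (n G) × Fin (n H) → Set
□-Edge G H (u , w) (u' , w') = (u ≡ u' × adj H w w' ≡ true) ⊎ (w ≡ w' × adj G u u' ≡ true)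

□-adj-combine⁺ : (G H : Graph) {u u' : Fin (n G)} {w w' : Fin (n H)} →
                 □-Edge G H (u , w) (u' , w') → adj (G □ H) (combine u w) (combine u' w') ≡ true
□-adj-combine⁺ G H {u} {u'} {w} {w'} edge = trans (adj-□-combine G H u u' w w') (by-cases edge)
  where
  by-cases : □-Edge G H (u , w) (u' , w') → □-adjᵖ G H (u , w) (u' , w') ≡ true
  by-cases (inj₁ (refl , ww')) rewrite Equivalence.to T-≡ (≡⇒≡ᵇ (toℕ u) _ refl) | ww' = refl
  by-cases (inj₂ (refl , uu')) rewrite Equivalence.to T-≡ (≡⇒≡ᵇ (toℕ w) _ refl) | uu' = ∨-zeroʳ _

□-adj⁻ : (G H : Graph) {i j : Fin (n (G □ H))} →
         adj (G □ H) i j ≡ true → □-Edge G H (remQuot (n H) i) (remQuot (n H) j)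
□-adj⁻ G H e with Equivalence.to T-∨ (Equivalence.from T-≡ e)
... | inj₁ t = let eq , edge = Equivalence.to T-∧ t in inj₁ (toℕ-≡ᵇ⇒≡ eq , Equivalence.to T-≡ edge)
... | inj₂ t = let eq , edge = Equivalence.to T-∧ t in inj₂ (toℕ-≡ᵇ⇒≡ eq , Equivalence.to T-≡ edge)

record SubgraphEmbedding (H G : Graph) : Set where
  field
    embed         : Fin (n H) → Fin (n G)
    retract       : Fin (n G) → Maybe (Fin (n H))
    retract-embed : ∀ i → retract (embed i) ≡ just i
    embed-adj     : ∀ i j → adj H i j ≡ true → adj G (embed i) (embed j) ≡ true

Choosable-subgraph : {H G : Graph} {k : ℕ} → SubgraphEmbedding H G → Choosable G k → Choosable H k
Choosable-subgraph {H} {G} {k} ι choosable L L-isK = c ∘ embed , c∈L , proper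
  where
  open SubgraphEmbedding ι
  extended : ListAssignment G
  extended j = maybe′ L (upTo k) (retract j)
  extended-embed : ∀ i → extended (embed i) ≡ L i
  extended-embed i = cong (maybe′ L (upTo k)) (retract-embed i)
  extended-isK : IsKAssignment G k extended
  extended-isK j with retract j
  ... | just i  = L-isK i
  ... | nothing = upTo⁺ k , length-upTo k
  open Σ (choosable extended extended-isK) renaming (proj₁ to c; proj₂ to c-proper)
  c∈L : ∀ i → c (embed i) ∈ L i
  c∈L i = subst (c (embed i) ∈_) (extended-embed i) (proj₁ c-proper (embed i))
  proper : ∀ i j → adj H i j ≡ true → c (embed i) ≢ c (embed j)
  proper i j e = proj₂ c-proper (embed i) (embed j) (embed-adj i j e)

□-subgraphʳ : (G : Graph) {H H' : Graph} → SubgraphEmbedding H H' → SubgraphEmbedding (G □ H) (G □ H')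
□-subgraphʳ G {H} {H'} ι = record
  { embed         = embed□
  ; retract       = retract□
  ; retract-embed = retract-embed□
  ; embed-adj     = λ i j e → □-adj-combine⁺ G H' (map-edge (□-adj⁻ G H e))
  }
  where
  open SubgraphEmbedding ι
  embed□ : Fin (n (G □ H)) → Fin (n (G □ H'))
  embed□ i = uncurry (λ u w → combine {n G} u (embed w)) (remQuot {n G} (n H) i)
  retract□ : Fin (n (G □ H')) → Maybe (Fin (n (G □ H)))
  retract□ j = uncurry (λ u w → Maybe.map (combine {n G} u) (retract w)) (remQuot {n G} (n H') j)
  retract-embed□ : ∀ i → retract□ (embed□ i) ≡ just i
  retract-embed□ i = begin
    retract□ (combine u (embed w))             ≡⟨ cong (uncurry (λ u w → Maybe.map (combine {n G} u) (retract w)))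
                                                       (remQuot-combine {n G} {n H'} u (embed w)) ⟩
    Maybe.map (combine u) (retract (embed w))  ≡⟨ cong (Maybe.map (combine u)) (retract-embed w) ⟩
    just (combine u w)                         ≡⟨ cong just (combine-remQuot {n G} (n H) i) ⟩
    just i                                     ∎
    where
    open ≡-Reasoning
    u : Fin (n G)
    u = proj₁ (remQuot {n G} (n H) i)
    w : Fin (n H)
    w = proj₂ (remQuot {n G} (n H) i)
  map-edge : ∀ {p q} → □-Edge G H p q → □-Edge G H' (proj₁ p , embed (proj₂ p)) (proj₁ q , embed (proj₂ q))
  map-edge {_ , w} {_ , w'} (inj₁ (uu' , ww')) = inj₁ (uu' , embed-adj w w' ww')
  map-edge (inj₂ (ww' , uu')) = inj₂ (cong embed ww' , uu')

K-subgraph : (a : ℕ) {B b : ℕ} → B ≤ b → SubgraphEmbedding (K a B) (K a b)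
K-subgraph a {B} {b} B≤b = record
  { embed         = embed
  ; retract       = retract
  ; retract-embed = retract-embed
  ; embed-adj     = λ w w' e → subst₂ (λ x y → ((x <ᵇ a) xor (y <ᵇ a)) ≡ true)
                                 (sym (toℕ-inject≤ w a+B≤a+b)) (sym (toℕ-inject≤ w' a+B≤a+b)) e
  }
  where
  a+B≤a+b : a + B ≤ a + b
  a+B≤a+b = +-monoʳ-≤ a B≤b
  embed : Fin (a + B) → Fin (a + b)
  embed w = inject≤ w a+B≤a+b
  retract : Fin (a + b) → Maybe (Fin (a + B))
  retract w with toℕ w <? a + B
  ... | yes w<a+B = just (fromℕ< w<a+B)
  ... | no  _     = nothing
  retract-embed : ∀ w → retract (embed w) ≡ just w
  retract-embed w with toℕ (embed w) <? a + B
  ... | yes lt = cong just (toℕ-injective (trans (toℕ-fromℕ< lt) (toℕ-inject≤ w a+B≤a+b)))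
  ... | no ¬lt = ⊥-elim (¬lt (subst (_< a + B) (sym (toℕ-inject≤ w a+B≤a+b)) (toℕ<n w)))

mixed-radix-injective : ∀ {s} .{{_ : NonZero s}} {t t' x x'} → t < s → t' < s →
                        t + x * s ≡ t' + x' * s → t ≡ t' × x ≡ x'
mixed-radix-injective {s} {t} {t'} {x} {x'} t<s t'<s eq = t≡t' , x≡x'
  where
  open ≡-Reasoning
  t≡t' : t ≡ t'
  t≡t' = begin
    t                ≡⟨ m<n⇒m%n≡m t<s ⟨
    t % s            ≡⟨ [m+kn]%n≡m%n t x s ⟨
    (t + x * s) % s  ≡⟨ cong (_% s) eq ⟩
    (t' + x' * s) % s ≡⟨ [m+kn]%n≡m%n t' x' s ⟩
    t' % s           ≡⟨ m<n⇒m%n≡m t'<s ⟩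
    t'               ∎
  x≡x' : x ≡ x'
  x≡x' = *-cancelʳ-≡ x x' s (+-cancelˡ-≡ t _ _ (trans eq (cong (_+ x' * s) (sym t≡t'))))

K-adj-↑ʳ-↑ˡ : (a B : ℕ) (β : Fin B) (α : Fin a) → adj (K a B) (a ↑ʳ β) (α ↑ˡ B) ≡ true
K-adj-↑ʳ-↑ˡ a B β α rewrite toℕ-↑ʳ a β | toℕ-↑ˡ α B with a + toℕ β <ᵇ a in a+β<a
... | true  = contradiction (≤-<-trans (m≤m+n a (toℕ β)) (<ᵇ⇒< _ _ (subst T (sym a+β<a) _))) (<-irrefl refl)
... | false with toℕ α <ᵇ a in α<a
...   | true  = refl
...   | false = contradiction (<⇒<ᵇ (toℕ<n α)) (subst T α<a)

module ProductAssignment (G : Graph) (a k : ℕ) (L₀ : ListAssignment G) (L₀-isK : IsKAssignment G (k + a) L₀) where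

  colorings : List (Vec ℕ (n G))
  colorings = properColorings G L₀

  B : ℕ
  B = length colorings ^ a

  -- Colour x in palette t ≤ a: palette α < a serves the α-th vertex of the first side of K a B,
  -- palette a the lists S; disjoint palettes keep every list of the product a set.
  tag : ℕ → ℕ → ℕ
  tag t x = t + x * suc a

  tag-injectiveʳ : ∀ {t x x'} → t < suc a → tag t x ≡ tag t x' → x ≡ x'
  tag-injectiveʳ {t} {x} {x'} t<1+a = proj₂ ∘ mixed-radix-injective {t = t} {x = x} {x'} t<1+a t<1+a

  tag-injectiveˡ : ∀ {t t' x x'} → t < suc a → t' < suc a → tag t x ≡ tag t' x' → t ≡ t'
  tag-injectiveˡ {x = x} {x'} t<1+a t'<1+a = proj₁ ∘ mixed-radix-injective {x = x} {x'} t<1+a t'<1+a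

  toℕ<1+a : (α : Fin a) → toℕ α < suc a
  toℕ<1+a α = m<n⇒m<1+n (toℕ<n α)

  -- Each β : Fin B encodes an a-tuple of proper L₀-colourings.
  coloringOf : Fin B → Fin a → Fin (n G) → ℕ
  coloringOf β α = Vec.lookup (List.lookup colorings (finToFun β α))

  module _ (S : ListAssignment G) (S-isK : IsKAssignment G k S) where

    sideLists : Fin (n G) → Fin a ⊎ Fin B → List ℕ
    sideLists u (inj₁ α) = map (tag (toℕ α)) (L₀ u)
    sideLists u (inj₂ β) = map (tag a) (S u) ++ tabulate (λ α → tag (toℕ α) (coloringOf β α u))

    lists : ListAssignment (G □ K a B)
    lists i = uncurry (λ u w → sideLists u (splitAt a w)) (remQuot {n G} (a + B) i)

    sideLists-isK : ∀ u side → Unique (sideLists u side) × length (sideLists u side) ≡ k + a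
    sideLists-isK u (inj₁ α) =
      map⁺ (tag-injectiveʳ (toℕ<1+a α)) (proj₁ (L₀-isK u)) ,
      trans (length-map _ (L₀ u)) (proj₂ (L₀-isK u))
    sideLists-isK u (inj₂ β) =
      ++⁺ (map⁺ (tag-injectiveʳ (n<1+n a)) (proj₁ (S-isK u)))
          (tabulate⁺ λ {α α'} → toℕ-injective ∘ tag-injectiveˡ {x = coloringOf β α u} {coloringOf β α' u}
                                                     (toℕ<1+a α) (toℕ<1+a α'))
          disjoint ,
      trans (length-++ (map (tag a) (S u)))
            (cong₂ _+_ (trans (length-map _ (S u)) (proj₂ (S-isK u))) (length-tabulate _))
      where
      disjoint : ∀ {x} → ¬ (x ∈ map (tag a) (S u) × x ∈ tabulate (λ α → tag (toℕ α) (coloringOf β α u)))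
      disjoint (x∈S , x∈tab) with ∈-map⁻ (tag a) x∈S | ∈-tabulate⁻ x∈tab
      ... | y , _ , refl | α , eq =
        <-irrefl (sym (tag-injectiveˡ {x = y} {coloringOf β α u} (n<1+n a) (toℕ<1+a α) eq)) (toℕ<n α)

    lists-isK : IsKAssignment (G □ K a B) (k + a) lists
    lists-isK i = uncurry (λ u w → sideLists-isK u (splitAt a w)) (remQuot {n G} (a + B) i)

    module _ (c : Fin (n (G □ K a B)) → ℕ) (c-proper : IsProperLColoring (G □ K a B) lists c) where

      c∈sideLists : ∀ u w → c (combine u w) ∈ sideLists u (splitAt a w)
      c∈sideLists u w = subst (λ (u' , w') → c (combine u w) ∈ sideLists u' (splitAt a w'))
                              (remQuot-combine {n G} {a + B} u w) (proj₁ c-proper (combine u w))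

      decoded-proper : ∀ t w (M : ListAssignment G) →
                       (decode : ∀ u → ∃ λ x → x ∈ M u × c (combine u w) ≡ tag t x) →
                       IsProperLColoring G M (proj₁ ∘ decode)
      decoded-proper t w M decode = proj₁ ∘ proj₂ ∘ decode , λ u v uv same →
        proj₂ c-proper _ _ (□-adj-combine⁺ G (K a B) (inj₂ (refl , uv)))
          (trans (proj₂ (proj₂ (decode u))) (trans (cong (tag t) same) (sym (proj₂ (proj₂ (decode v))))))

      decodeFirst : ∀ α u → ∃ λ x → x ∈ L₀ u × c (combine u (α ↑ˡ B)) ≡ tag (toℕ α) x
      decodeFirst α u = ∈-map⁻ _ (subst (λ side → c (combine u (α ↑ˡ B)) ∈ sideLists u side)
                                        (splitAt-↑ˡ a α B) (c∈sideLists u (α ↑ˡ B)))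

      firstSide : Fin a → Fin (n G) → ℕ
      firstSide α = proj₁ ∘ decodeFirst α

      firstSide∈colorings : ∀ α → Vec.tabulate (firstSide α) ∈ colorings
      firstSide∈colorings α = ∈-properColorings G L₀ _ (decoded-proper (toℕ α) (α ↑ˡ B) L₀ (decodeFirst α))

      -- The vertex of the second side indexing the tuple of colourings seen on the first side.
      β₀ : Fin B
      β₀ = funToFin (index ∘ firstSide∈colorings)

      coloringOf-β₀ : ∀ α u → coloringOf β₀ α u ≡ firstSide α u
      coloringOf-β₀ α u = begin
        Vec.lookup (List.lookup colorings (finToFun β₀ α)) u
          ≡⟨ cong (λ i → Vec.lookup (List.lookup colorings i) u) (finToFun-funToFin _ α) ⟩
        Vec.lookup (List.lookup colorings (index (firstSide∈colorings α))) u
          ≡⟨ cong (λ v → Vec.lookup v u) (lookup-index (firstSide∈colorings α)) ⟨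
        Vec.lookup (Vec.tabulate (firstSide α)) u
          ≡⟨ lookup∘tabulate _ u ⟩
        firstSide α u ∎
        where open ≡-Reasoning

      -- Colour tag α (firstSide α u) is taken by the neighbour (u , α) of (u , β₀).
      decodeSecond : ∀ u → ∃ λ x → x ∈ S u × c (combine u (a ↑ʳ β₀)) ≡ tag a x
      decodeSecond u with ∈-++⁻ (map (tag a) (S u))
                            (subst (λ side → c (combine u (a ↑ʳ β₀)) ∈ sideLists u side)
                                   (splitAt-↑ʳ a B β₀) (c∈sideLists u (a ↑ʳ β₀)))
      ... | inj₁ x∈S   = ∈-map⁻ (tag a) x∈S
      ... | inj₂ x∈tab with ∈-tabulate⁻ x∈tab
      ...   | α , same = ⊥-elim (proj₂ c-proper _ _ (□-adj-combine⁺ G (K a B) (inj₁ (refl , K-adj-↑ʳ-↑ˡ a B β₀ α)))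
                           (trans same (trans (cong (tag (toℕ α)) (coloringOf-β₀ α u))
                                              (sym (proj₂ (proj₂ (decodeFirst α u)))))))

      secondSide : Σ (Fin (n G) → ℕ) (IsProperLColoring G S)
      secondSide = proj₁ ∘ decodeSecond , decoded-proper a (a ↑ʳ β₀) S decodeSecond

  Choosable-□K⇒Choosable : Choosable (G □ K a B) (k + a) → Choosable G k
  Choosable-□K⇒Choosable choosable S S-isK =
    uncurry (secondSide S S-isK) (choosable (lists S S-isK) (lists-isK S S-isK))

Choosable-□K-reflect : (G : Graph) {a k : ℕ} (L₀ : ListAssignment G) → IsKAssignment G (k + a) L₀ →
                       Choosable (G □ K a (numLColorings G L₀ ^ a)) (k + a) → Choosable G k
Choosable-□K-reflect G {a} {k} L₀ L₀-isK =
  ProductAssignment.Choosable-□K⇒Choosable G a k L₀ L₀-isK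
  ∘ subst (λ N → Choosable (G □ K a (N ^ a)) (k + a)) (numLColorings≡length G L₀)

theorem1p5 : (G : Graph) → IsSimple G → IsNonempty G →
               (a : ℕ) → 1 ≤ a →
               (χ p b : ℕ) →
               IsListChromaticNumber G χ →
               IsListColorFunction G (χ + a ∸ 1) p →
               IsF G a χ b →
               b ≤ p ^ a
theorem1p5 G _ nonempty a 1≤a zero p b (0-choosable , _) _ _ =
  ⊥-elim (¬Choosable-0 G nonempty 0-choosable)
theorem1p5 G _ _ a 1≤a (suc k) _ b (χ-choosable , below-χ) ((L₀ , L₀-isK , refl) , _)
           (_ , (b-choosable , _) , b-least) =
  ≮⇒≥ λ p^a<b → b-least (p ^ a) p^a>0 p^a<b
    (Choosable-subgraph (□-subgraphʳ G (K-subgraph a (<⇒≤ p^a<b))) b-choosable , not-below)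
  where
  p : ℕ
  p = numLColorings G L₀
  χ≤k+a : suc k ≤ k + a
  χ≤k+a = subst (_≤ k + a) (+-comm k 1) (+-monoʳ-≤ k 1≤a)
  L₀-colorable : Σ (Fin (n G) → ℕ) (IsProperLColoring G L₀)
  L₀-colorable = Choosable-mono G χ≤k+a χ-choosable L₀ L₀-isK
  p^a>0 : 0 < p ^ a
  p^a>0 = m^n>0 p {{>-nonZero (numLColorings>0 G L₀ (proj₂ L₀-colorable))}} a
  not-below : ∀ j → j < suc k + a → ¬ Choosable (G □ K a (p ^ a)) j
  not-below j j<χ+a j-choosable =
    below-χ k (n<1+n k) (Choosable-□K-reflect G L₀ L₀-isK (Choosable-mono _ (≤-pred j<χ+a) j-choosable))
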